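{- Let $p$ be a prime, $d\geq 1$, let $Y\subset\mathbb{F}_p^d$ be an arbitrary set and let $w:Y\to\mathbb{N}$ be a function such that $\sum_{y\in Y}w(y)\geq d(p-1)+2r|Y|+1$ for some $r\geq 0$. Then there exist integers $a_y\in\mathbb{N}$, one for each $y\in Y$, not all zero, such that $a_y\in\{0\}\cup[r,w(y)-r]$ for every $y\in Y$ and $\sum_{y\in Y}a_y y=0$ in $\mathbb{F}_p^d$.
   Context: $\mathbb{N}$ includes $0$; $[r,w(y)-r]$ denotes the set of integers $a$ with $r\leq a\leq w(y)-r$. -}

module Defs where

open import Data.Nat using (ℕ; _+_; _*_)
open import Data.Fin using (Fin; toℕ)
open import Data.Vec using (Vec; lookup)
open import Data.List using (List; map)
open import Data.Nat.ListAction using (sum)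

Point : ℕ → ℕ → Set
Point p d = Vec (Fin p) d

-- i-th coordinate (as a natural number) of the integer combination
-- Σ_{y ∈ Y} a_y · y, computed in ℕ before reduction mod p.
coordSum : ∀ {p d} → List (Point p d) → (Point p d → ℕ) → Fin d → ℕ
coordSum Y a i = sum (map (λ y → a y * toℕ (lookup y i)) Y)

module Submission where

-- Polynomial method, with finite differences on ℕᵈ in place of polynomials over 𝔽ₚ.
-- Translates of products ∏ᵢ Δ^kᵢ δₚ(vᵢ), where δₚ is the indicator of pℤ, have order Σᵢ kᵢ,
-- and each difference operator Δ[ g ] raises the order by one.  Since (1 − T)ᵖ ≡ 1 − Tᵖ
-- (mod p) and δₚ is p-periodic, Δᵏ δₚ ≡ 0 (mod p) for k ≥ p, so every function of order
-- > d(p − 1) vanishes mod p.  For each y ∈ Y there is a combination of the translates by k·y,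
-- with coefficient 1 at k = 0 and all other k in [max(r,1), w(y) − r], that raises the order by
-- w(y) − 2r.  Applying all of them to δ = ∏ᵢ δₚ(vᵢ) gives order Σ (w(y) − 2r) > d(p − 1), hence
-- a value ≡ 0 (mod p) at 0.  If no nonzero admissible (a_y) had Σ a_y y ≡ 0, every translate but
-- the trivial one would contribute δ(Σ a_y y) = 0, and that value would be δ(0) = 1.

open import Defs
open import Data.Nat as ℕ using (ℕ; zero; suc; _≤_; _<_; z≤n; s≤s)
import Data.Nat.Properties as ℕ
import Data.Nat.Tactic.RingSolver as ℕ-Solver
open import Data.Nat.Combinatorics using (_C_; nCk+nC[k+1]≡[n+1]C[k+1]; k>n⇒nCk≡0; nCn≡1; nC1≡n)
open import Data.Nat.Primality using (Prime; euclidsLemma; prime⇒irreducible; ¬prime[0]; ¬prime[1])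
open import Data.Nat.GeneralisedArithmetic using (iterate)
open import Data.Nat.ListAction using (sum)
open import Data.Integer as ℤ using (ℤ; +_; 0ℤ; 1ℤ; -1ℤ)
import Data.Integer.Properties as ℤ
open import Data.Integer.Divisibility.Signed using (∣ᵤ⇒∣; ∣⇒∣ᵤ) renaming (_∣_ to _∣ᶻ_)
open import Data.Fin as Fin using (Fin; toℕ)
import Data.Fin.Properties as Fin
open import Data.Vec as Vec using (Vec; []; _∷_; lookup; replicate; zipWith)
import Data.Vec.Properties as Vec
open import Data.List using (List; []; _∷_; map; length)
open import Data.List.Relation.Unary.All as All using (All)
open import Data.List.Relation.Unary.Any using (here; there)
open import Data.List.Relation.Unary.AllPairs using ([]; _∷_)
open import Data.List.Relation.Unary.Unique.Propositional using (Unique)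
open import Data.List.Membership.Propositional using (_∈_)
open import Data.Product using (_×_; _,_; ∃-syntax)
open import Data.Sum using (_⊎_; inj₁; inj₂; [_,_])
open import Data.Empty using (⊥; ⊥-elim)
open import Function using (_∘_; _∘′_)
open import Relation.Nullary using (yes; no; contradiction)
open import Relation.Binary.PropositionalEquality hiding ([_])

module _ where

  open import Data.Integer using (-_; _+_; _-_; _*_)
  open import Data.Nat.Divisibility using (_∣_; divides; ∣⇒≤)
  open import Data.Integer.Divisibility.Signed using (∣-refl; ∣m∣n⇒∣m+n; ∣m∣n⇒∣m-n; ∣m⇒∣m*n; ∣n⇒∣m*n)
  open import Data.Integer.Tactic.RingSolver using (solve-∀)

  [k+1]*[n+1]C[k+1]≡[n+1]*nCk : ∀ n k → suc k ℕ.* (suc n C suc k) ≡ suc n ℕ.* (n C k)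
  [k+1]*[n+1]C[k+1]≡[n+1]*nCk n zero =
    trans (ℕ.+-identityʳ _) (trans (nC1≡n (suc n)) (sym (ℕ.*-identityʳ (suc n))))
  [k+1]*[n+1]C[k+1]≡[n+1]*nCk zero (suc k) =
    trans (cong (suc (suc k) ℕ.*_) (k>n⇒nCk≡0 {1} {suc (suc k)} (s≤s (s≤s z≤n)))) (ℕ.*-zeroʳ (suc (suc k)))
  [k+1]*[n+1]C[k+1]≡[n+1]*nCk (suc n) (suc k) = begin
    suc (suc k) ℕ.* (suc (suc n) C suc (suc k))
      ≡⟨ cong (suc (suc k) ℕ.*_) (sym (nCk+nC[k+1]≡[n+1]C[k+1] (suc n) (suc k))) ⟩
    suc (suc k) ℕ.* (A ℕ.+ B)
      ≡⟨ expand k A B ⟩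
    suc k ℕ.* A ℕ.+ A ℕ.+ suc (suc k) ℕ.* B
      ≡⟨ cong₂ (λ u v → u ℕ.+ A ℕ.+ v) ([k+1]*[n+1]C[k+1]≡[n+1]*nCk n k)
                                        ([k+1]*[n+1]C[k+1]≡[n+1]*nCk n (suc k)) ⟩
    suc n ℕ.* (n C k) ℕ.+ A ℕ.+ suc n ℕ.* (n C suc k)
      ≡⟨ collect n A (n C k) (n C suc k) ⟩
    suc n ℕ.* (n C k ℕ.+ n C suc k) ℕ.+ A
      ≡⟨ cong (λ u → suc n ℕ.* u ℕ.+ A) (nCk+nC[k+1]≡[n+1]C[k+1] n k) ⟩
    suc n ℕ.* A ℕ.+ A
      ≡⟨ ℕ.+-comm (suc n ℕ.* A) A ⟩
    suc (suc n) ℕ.* A ∎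
    where
    open ≡-Reasoning
    A B : ℕ
    A = suc n C suc k
    B = suc n C suc (suc k)
    expand : ∀ k A B → suc (suc k) ℕ.* (A ℕ.+ B) ≡ suc k ℕ.* A ℕ.+ A ℕ.+ suc (suc k) ℕ.* B
    expand = ℕ-Solver.solve-∀
    collect : ∀ n A c c′ → suc n ℕ.* c ℕ.+ A ℕ.+ suc n ℕ.* c′ ≡ suc n ℕ.* (c ℕ.+ c′) ℕ.+ A
    collect = ℕ-Solver.solve-∀

  prime∣pCk : ∀ {p k} → Prime p → 0 < k → k < p → p ∣ p C k
  prime∣pCk {suc n} {suc j} p-prime _ k<p
    with euclidsLemma (suc j) (suc n C suc j) p-prime
           (divides (n C j) (trans ([k+1]*[n+1]C[k+1]≡[n+1]*nCk n j) (ℕ.*-comm (suc n) (n C j))))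
  ... | inj₁ p∣k = contradiction (∣⇒≤ p∣k) (ℕ.<⇒≱ k<p)
  ... | inj₂ p∣C = p∣C

  ∣ᶻ0 : ∀ {q} → q ∣ᶻ 0ℤ
  ∣ᶻ0 = ∣ᵤ⇒∣ (divides 0 refl)

  sign : ℕ → ℤ
  sign zero          = 1ℤ
  sign (suc zero)    = -1ℤ
  sign (suc (suc n)) = sign n

  sign-suc : ∀ n → sign (suc n) ≡ - sign n
  sign-suc zero    = refl
  sign-suc (suc n) = sym (trans (cong -_ (sign-suc n)) (ℤ.neg-involutive (sign n)))

  sign≡-1⊎2∣ : ∀ n → sign n ≡ -1ℤ ⊎ 2 ∣ n
  sign≡-1⊎2∣ zero          = inj₂ (divides 0 refl)
  sign≡-1⊎2∣ (suc zero)    = inj₁ refl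
  sign≡-1⊎2∣ (suc (suc n)) with sign≡-1⊎2∣ n
  ... | inj₁ e              = inj₁ e
  ... | inj₂ (divides q eq) = inj₂ (divides (suc q) (cong (suc ∘ suc) eq))

  prime∣1+sign : ∀ {p} → Prime p → + p ∣ᶻ 1ℤ + sign p
  prime∣1+sign {p} p-prime with sign≡-1⊎2∣ p
  ... | inj₁ e   = subst (λ s → + p ∣ᶻ 1ℤ + s) (sym e) ∣ᶻ0
  ... | inj₂ 2∣p with prime⇒irreducible p-prime 2∣p
  ...   | inj₂ refl = ∣-refl

  ∑< : ℕ → (ℕ → ℤ) → ℤ
  ∑< zero    f = 0ℤ
  ∑< (suc n) f = f 0 + ∑< n (f ∘ suc)

  ∑<-cong : ∀ n {f g} → (∀ j → f j ≡ g j) → ∑< n f ≡ ∑< n g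
  ∑<-cong zero    f≗g = refl
  ∑<-cong (suc n) f≗g = cong₂ _+_ (f≗g 0) (∑<-cong n (f≗g ∘ suc))

  ∑<-distrib-- : ∀ n f g → ∑< n (λ j → f j - g j) ≡ ∑< n f - ∑< n g
  ∑<-distrib-- zero    f g = refl
  ∑<-distrib-- (suc n) f g =
    trans (cong (_+_ (f 0 - g 0)) (∑<-distrib-- n (f ∘ suc) (g ∘ suc)))
          (interchange (f 0) (g 0) (∑< n (f ∘ suc)) (∑< n (g ∘ suc)))
    where
    interchange : ∀ a b c d → a - b + (c - d) ≡ a + c - (b + d)
    interchange = solve-∀

  ∑<-last : ∀ n f → ∑< (suc n) f ≡ ∑< n f + f n
  ∑<-last zero    f = ℤ.+-comm (f 0) 0ℤ
  ∑<-last (suc n) f = trans (cong (_+_ (f 0)) (∑<-last n (f ∘ suc))) (sym (ℤ.+-assoc (f 0) _ _))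

  ∑<-∣ : ∀ {q} n f → (∀ j → j < n → q ∣ᶻ f j) → q ∣ᶻ ∑< n f
  ∑<-∣ zero    f q∣f = ∣ᶻ0
  ∑<-∣ (suc n) f q∣f = ∣m∣n⇒∣m+n (q∣f 0 (s≤s z≤n)) (∑<-∣ n (f ∘ suc) (λ j j<n → q∣f (suc j) (s≤s j<n)))

  Δ : (ℕ → ℤ) → ℕ → ℤ
  Δ f x = f x - f (suc x)

  Δ^ : ℕ → (ℕ → ℤ) → ℕ → ℤ
  Δ^ zero    f = f
  Δ^ (suc k) f = Δ (Δ^ k f)

  signedBinom : ℕ → ℕ → ℤ
  signedBinom n j = sign j * + (n C j)

  signedBinom[n,1+n]≡0 : ∀ n → signedBinom n (suc n) ≡ 0ℤ
  signedBinom[n,1+n]≡0 n =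
    trans (cong (λ c → sign (suc n) * + c) (k>n⇒nCk≡0 (ℕ.n<1+n n))) (ℤ.*-zeroʳ (sign (suc n)))

  signedBinom-pascal : ∀ n j → signedBinom (suc n) (suc j) ≡ signedBinom n (suc j) - signedBinom n j
  signedBinom-pascal n j = begin
    sign (suc j) * + (suc n C suc j)
      ≡⟨ cong₂ (λ s c → s * + c) (sign-suc j) (sym (nCk+nC[k+1]≡[n+1]C[k+1] n j)) ⟩
    - sign j * + (n C j ℕ.+ n C suc j)
      ≡⟨ cong (- sign j *_) (ℤ.pos-+ (n C j) (n C suc j)) ⟩
    - sign j * (+ (n C j) + + (n C suc j))
      ≡⟨ rearrange (sign j) (+ (n C j)) (+ (n C suc j)) ⟩
    - sign j * + (n C suc j) - sign j * + (n C j)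
      ≡⟨ cong (λ s → s * + (n C suc j) - signedBinom n j) (sym (sign-suc j)) ⟩
    signedBinom n (suc j) - signedBinom n j ∎
    where
    open ≡-Reasoning
    rearrange : ∀ s a b → - s * (a + b) ≡ - s * b - s * a
    rearrange = solve-∀

  Δ^-expansion : ∀ n f x → Δ^ n f x ≡ ∑< (suc n) (λ j → signedBinom n j * f (x ℕ.+ j))
  Δ^-expansion zero    f x = trans (cong f (sym (ℕ.+-identityʳ x))) (unit (f (x ℕ.+ 0)))
    where
    unit : ∀ a → a ≡ 1ℤ * a + 0ℤ
    unit = solve-∀
  Δ^-expansion (suc n) f x = begin
    Δ^ n f x - Δ^ n f (suc x)
      ≡⟨ cong₂ _-_ (Δ^-expansion n f x) (Δ^-expansion n f (suc x)) ⟩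
    f₀ + ∑< n g - ∑< (suc n) (λ j → signedBinom n j * f (suc x ℕ.+ j))
      ≡⟨ cong₂ (λ u v → f₀ + u - v) (sym ∑<[1+n]g≡∑<[n]g) (∑<-cong (suc n) shift-h) ⟩
    f₀ + ∑< (suc n) g - ∑< (suc n) h
      ≡⟨ ℤ.+-assoc f₀ (∑< (suc n) g) (- ∑< (suc n) h) ⟩
    f₀ + (∑< (suc n) g - ∑< (suc n) h)
      ≡⟨ cong (_+_ f₀) (sym (∑<-distrib-- (suc n) g h)) ⟩
    f₀ + ∑< (suc n) (λ j → g j - h j)
      ≡⟨ cong (_+_ f₀) (∑<-cong (suc n) pascal) ⟩
    f₀ + ∑< (suc n) (λ j → signedBinom (suc n) (suc j) * f (x ℕ.+ suc j)) ∎
    where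
    open ≡-Reasoning
    f₀ : ℤ
    f₀ = signedBinom n 0 * f (x ℕ.+ 0)
    g h : ℕ → ℤ
    g j = signedBinom n (suc j) * f (x ℕ.+ suc j)
    h j = signedBinom n j * f (x ℕ.+ suc j)
    shift-h : ∀ j → signedBinom n j * f (suc x ℕ.+ j) ≡ h j
    shift-h j = cong (λ y → signedBinom n j * f y) (sym (ℕ.+-suc x j))
    factor : ∀ a b c → a * c - b * c ≡ (a - b) * c
    factor = solve-∀
    pascal : ∀ j → g j - h j ≡ signedBinom (suc n) (suc j) * f (x ℕ.+ suc j)
    pascal j = trans (factor (signedBinom n (suc j)) (signedBinom n j) (f (x ℕ.+ suc j)))
                     (cong (_* f (x ℕ.+ suc j)) (sym (signedBinom-pascal n j)))
    ∑<[1+n]g≡∑<[n]g : ∑< (suc n) g ≡ ∑< n g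
    ∑<[1+n]g≡∑<[n]g = begin
      ∑< (suc n) g
        ≡⟨ ∑<-last n g ⟩
      ∑< n g + g n
        ≡⟨ cong (λ c → ∑< n g + c * f (x ℕ.+ suc n)) (signedBinom[n,1+n]≡0 n) ⟩
      ∑< n g + 0ℤ * f (x ℕ.+ suc n)
        ≡⟨ ℤ.+-identityʳ (∑< n g) ⟩
      ∑< n g ∎

  Δ^p-frobenius : ∀ {p} → Prime p → ∀ f x → + p ∣ᶻ Δ^ p f x - (f x - f (x ℕ.+ p))
  Δ^p-frobenius {p@(suc n)} p-prime f x =
    subst (+ p ∣ᶻ_) (sym expansion) (∣m∣n⇒∣m+n ∣middle (∣m⇒∣m*n (f (x ℕ.+ p)) (prime∣1+sign p-prime)))
    where
    F : ℕ → ℤ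
    F j = signedBinom p j * f (x ℕ.+ j)
    M : ℤ
    M = ∑< n (F ∘ suc)
    ∣middle : + p ∣ᶻ M
    ∣middle = ∑<-∣ n (F ∘ suc) λ j j<n →
      ∣m⇒∣m*n _ (∣n⇒∣m*n (sign (suc j)) (∣ᵤ⇒∣ (prime∣pCk p-prime (s≤s z≤n) (s≤s j<n))))
    F₀ : F 0 ≡ f x
    F₀ = trans (ℤ.*-identityˡ (f (x ℕ.+ 0))) (cong f (ℕ.+-identityʳ x))
    Fₚ : F p ≡ sign p * f (x ℕ.+ p)
    Fₚ = trans (cong (λ c → sign p * + c * f (x ℕ.+ p)) (nCn≡1 p))
               (cong (_* f (x ℕ.+ p)) (ℤ.*-identityʳ (sign p)))
    rearrange : ∀ a b s M → a + (M + s * b) - (a - b) ≡ M + (1ℤ + s) * b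
    rearrange = solve-∀
    expansion : Δ^ p f x - (f x - f (x ℕ.+ p)) ≡ M + (1ℤ + sign p) * f (x ℕ.+ p)
    expansion = begin
      Δ^ p f x - (f x - f (x ℕ.+ p))
        ≡⟨ cong (_- (f x - f (x ℕ.+ p))) (Δ^-expansion p f x) ⟩
      F 0 + ∑< p (F ∘ suc) - (f x - f (x ℕ.+ p))
        ≡⟨ cong₂ (λ a S → a + S - (f x - f (x ℕ.+ p))) F₀ (∑<-last n (F ∘ suc)) ⟩
      f x + (M + F p) - (f x - f (x ℕ.+ p))
        ≡⟨ cong (λ b → f x + (M + b) - (f x - f (x ℕ.+ p))) Fₚ ⟩
      f x + (M + sign p * f (x ℕ.+ p)) - (f x - f (x ℕ.+ p))
        ≡⟨ rearrange (f x) (f (x ℕ.+ p)) (sign p) M ⟩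
      M + (1ℤ + sign p) * f (x ℕ.+ p) ∎
      where open ≡-Reasoning

  periodic⇒p∣Δ^k : ∀ {p} → Prime p → ∀ {f} → (∀ x → f (x ℕ.+ p) ≡ f x) →
                  ∀ {k} → p ≤ k → ∀ x → + p ∣ᶻ Δ^ k f x
  periodic⇒p∣Δ^k {p} p-prime {f} periodic {k} p≤k =
    subst (λ k → ∀ x → + p ∣ᶻ Δ^ k f x) (ℕ.m∸n+n≡m p≤k) (beyond (k ℕ.∸ p))
    where
    cancel : ∀ d a → d - (a - a) ≡ d
    cancel = solve-∀
    beyond : ∀ e x → + p ∣ᶻ Δ^ (e ℕ.+ p) f x
    beyond zero    x =
      subst (+ p ∣ᶻ_) (trans (cong (λ b → Δ^ p f x - (f x - b)) (periodic x)) (cancel (Δ^ p f x) (f x)))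
            (Δ^p-frobenius p-prime f x)
    beyond (suc e) x = ∣m∣n⇒∣m-n (beyond e x) (beyond e (suc x))

  infixl 6 _+ᵛ_
  _+ᵛ_ : ∀ {d} → Vec ℕ d → Vec ℕ d → Vec ℕ d
  _+ᵛ_ = zipWith ℕ._+_

  0ᵛ : ∀ {d} → Vec ℕ d
  0ᵛ = replicate _ 0

  +ᵛ-identityˡ : ∀ {d} (v : Vec ℕ d) → 0ᵛ +ᵛ v ≡ v
  +ᵛ-identityˡ = Vec.zipWith-identityˡ ℕ.+-identityˡ

  +ᵛ-identityʳ : ∀ {d} (v : Vec ℕ d) → v +ᵛ 0ᵛ ≡ v
  +ᵛ-identityʳ = Vec.zipWith-identityʳ ℕ.+-identityʳ

  +ᵛ-assoc : ∀ {d} (u v w : Vec ℕ d) → u +ᵛ v +ᵛ w ≡ u +ᵛ (v +ᵛ w)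
  +ᵛ-assoc = Vec.zipWith-assoc ℕ.+-assoc

  +ᵛ-swapʳ : ∀ {d} (u v w : Vec ℕ d) → u +ᵛ v +ᵛ w ≡ u +ᵛ w +ᵛ v
  +ᵛ-swapʳ u v w = begin
    u +ᵛ v +ᵛ w   ≡⟨ +ᵛ-assoc u v w ⟩
    u +ᵛ (v +ᵛ w) ≡⟨ cong (u +ᵛ_) (Vec.zipWith-comm ℕ.+-comm v w) ⟩
    u +ᵛ (w +ᵛ v) ≡⟨ +ᵛ-assoc u w v ⟨
    u +ᵛ w +ᵛ v   ∎
    where open ≡-Reasoning

  Fn : ℕ → Set
  Fn d = Vec ℕ d → ℤ

  Δ[_] : ∀ {d} → Vec ℕ d → Fn d → Fn d
  Δ[ g ] φ v = φ v - φ (v +ᵛ g)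

  Δ[0ᵛ]≡0 : ∀ {d} (φ : Fn d) v → Δ[ 0ᵛ ] φ v ≡ 0ℤ
  Δ[0ᵛ]≡0 φ v = trans (cong (λ u → φ v - φ u) (+ᵛ-identityʳ v)) (ℤ.+-inverseʳ (φ v))

  Δ[+ᵛ] : ∀ {d} g h (φ : Fn d) v → Δ[ g ] φ v + Δ[ h ] φ (v +ᵛ g) ≡ Δ[ g +ᵛ h ] φ v
  Δ[+ᵛ] g h φ v =
    trans (telescope (φ v) (φ (v +ᵛ g)) (φ (v +ᵛ g +ᵛ h))) (cong (λ u → φ v - φ u) (+ᵛ-assoc v g h))
    where
    telescope : ∀ a b c → a - b + (b - c) ≡ a - c
    telescope = solve-∀

  _⊗_ : ∀ {d} → (ℕ → ℤ) → Fn d → Fn (suc d)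
  (g ⊗ ψ) (t ∷ v) = g t * ψ v

  -- With T the translation by y, choice y r m = (1 − T)ᵐ · Σ_{j ≤ r} C(m − 1 + j, j) Tʲ;
  -- the recursion is Pascal's rule for these coefficients.
  choice : ∀ {d} → Vec ℕ d → ℕ → ℕ → Fn d → Fn d
  choice y r       zero    φ   = φ
  choice y zero    (suc m) φ   = Δ[ y ] (choice y zero m φ)
  choice y (suc r) (suc m) φ v = choice y r (suc m) φ (v +ᵛ y) + Δ[ y ] (choice y (suc r) m φ) v

  choice-fixes : ∀ {d} (y : Vec ℕ d) r m (φ : Fn d) v →
                 (∀ j → j < m → φ (iterate (_+ᵛ y) v (suc r ℕ.+ j)) ≡ 0ℤ) →
                 choice y r m φ v ≡ φ v
  choice-fixes y r       zero    φ v _     = refl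
  choice-fixes y zero    (suc m) φ v zeros = begin
    choice y 0 m φ v - choice y 0 m φ (v +ᵛ y)
      ≡⟨ cong₂ _-_ (choice-fixes y 0 m φ v (λ j j<m → zeros j (ℕ.m<n⇒m<1+n j<m)))
                   (choice-fixes y 0 m φ (v +ᵛ y) (λ j j<m → zeros (suc j) (s≤s j<m))) ⟩
    φ v - φ (v +ᵛ y)
      ≡⟨ cong (_-_ (φ v)) (zeros 0 (s≤s z≤n)) ⟩
    φ v - 0ℤ
      ≡⟨ ℤ.+-identityʳ (φ v) ⟩
    φ v ∎
    where open ≡-Reasoning
  choice-fixes y (suc r) (suc m) φ v zeros = begin
    choice y r (suc m) φ (v +ᵛ y) + (choice y (suc r) m φ v - choice y (suc r) m φ (v +ᵛ y))
      ≡⟨ cong₂ (λ a b → a + (b - choice y (suc r) m φ (v +ᵛ y)))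
               (choice-fixes y r (suc m) φ (v +ᵛ y) zeros)
               (choice-fixes y (suc r) m φ v (λ j j<m → zeros j (ℕ.m<n⇒m<1+n j<m))) ⟩
    φ (v +ᵛ y) + (φ v - choice y (suc r) m φ (v +ᵛ y))
      ≡⟨ cong (λ a → φ (v +ᵛ y) + (φ v - a)) (choice-fixes y (suc r) m φ (v +ᵛ y) zeros′) ⟩
    φ (v +ᵛ y) + (φ v - φ (v +ᵛ y))
      ≡⟨ cancel (φ (v +ᵛ y)) (φ v) ⟩
    φ v ∎
    where
    open ≡-Reasoning
    cancel : ∀ a b → a + (b - a) ≡ b
    cancel = solve-∀
    zeros′ : ∀ j → j < m → φ (iterate (_+ᵛ y) (v +ᵛ y) (suc (suc r) ℕ.+ j)) ≡ 0ℤ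
    zeros′ j j<m = subst (λ n → φ (iterate (_+ᵛ y) v n) ≡ 0ℤ) (cong suc (ℕ.+-suc (suc r) j))
                         (zeros (suc j) (s≤s j<m))

  m+n<o+p∧o≤m⇒n<p : ∀ {m n o p} → m ℕ.+ n < o ℕ.+ p → o ≤ m → n < p
  m+n<o+p∧o≤m⇒n<p {m} {n} {o} {p} m+n<o+p o≤m with n ℕ.<? p
  ... | yes n<p = n<p
  ... | no  n≮p = contradiction m+n<o+p (ℕ.≤⇒≯ (ℕ.+-mono-≤ o≤m (ℕ.≮⇒≥ n≮p)))

  module DifferenceProducts (f : ℕ → ℤ) where

    ∏Δ^ : ∀ {d} → Vec ℕ d → Fn d
    ∏Δ^ []       _ = 1ℤ
    ∏Δ^ (k ∷ ks)   = Δ^ k f ⊗ ∏Δ^ ks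

    -- For f = δₚ, Spanned b φ plays the role of "φ has degree ≤ d(p − 1) − b".
    data Spanned {d} (b : ℕ) : Fn d → Set where
      product : ∀ ks → b ≤ Vec.sum ks → Spanned b (∏Δ^ ks)
      null    : Spanned b (λ _ → 0ℤ)
      add     : ∀ {φ ψ} → Spanned b φ → Spanned b ψ → Spanned b (λ v → φ v + ψ v)
      shift   : ∀ g {φ} → Spanned b φ → Spanned b (λ v → φ (v +ᵛ g))
      ext     : ∀ {φ ψ} → (∀ v → φ v ≡ ψ v) → Spanned b φ → Spanned b ψ

    weaken : ∀ {d b c} {φ : Fn d} → b ≤ c → Spanned c φ → Spanned b φ
    weaken b≤c (product ks c≤) = product ks (ℕ.≤-trans b≤c c≤)
    weaken b≤c null            = null
    weaken b≤c (add φ ψ)       = add (weaken b≤c φ) (weaken b≤c ψ)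
    weaken b≤c (shift g φ)     = shift g (weaken b≤c φ)
    weaken b≤c (ext φ≗ψ φ)     = ext φ≗ψ (weaken b≤c φ)

    Δ^⊗-spanned : ∀ {d c} {ψ : Fn d} k → Spanned c ψ → Spanned (k ℕ.+ c) (Δ^ k f ⊗ ψ)
    Δ^⊗-spanned k (product ks c≤)  = product (k ∷ ks) (ℕ.+-monoʳ-≤ k c≤)
    Δ^⊗-spanned k null             =
      ext (λ { (t ∷ _) → sym (ℤ.*-zeroʳ (Δ^ k f t)) }) null
    Δ^⊗-spanned k (add {φ} {ψ} x y) =
      ext (λ { (t ∷ v) → sym (ℤ.*-distribˡ-+ (Δ^ k f t) (φ v) (ψ v)) })
          (add (Δ^⊗-spanned k x) (Δ^⊗-spanned k y))
    Δ^⊗-spanned k (shift g {φ} x)   =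
      ext (λ { (t ∷ v) → cong (λ s → Δ^ k f s * φ (v +ᵛ g)) (ℕ.+-identityʳ t) })
          (shift (0 ∷ g) (Δ^⊗-spanned k x))
    Δ^⊗-spanned k (ext φ≗ψ x)     =
      ext (λ { (t ∷ v) → cong (Δ^ k f t *_) (φ≗ψ v) }) (Δ^⊗-spanned k x)

    Δ[+ᵛ]-spanned : ∀ {d c} g h {e} (φ : Fn d) → g +ᵛ h ≡ e →
                    Spanned c (Δ[ g ] φ) → Spanned c (Δ[ h ] φ) → Spanned c (Δ[ e ] φ)
    Δ[+ᵛ]-spanned g h φ refl x y = ext (Δ[+ᵛ] g h φ) (add x (shift g y))

    Δ[e₀]∏Δ^-spanned : ∀ {d} k (ks : Vec ℕ d) →
                       Spanned (suc (k ℕ.+ Vec.sum ks)) (Δ[ 1 ∷ 0ᵛ ] (∏Δ^ (k ∷ ks)))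
    Δ[e₀]∏Δ^-spanned k ks = ext Δ[e₀]≡ (product (suc k ∷ ks) ℕ.≤-refl)
      where
      distribʳ-- : ∀ a b c → (a - b) * c ≡ a * c - b * c
      distribʳ-- = solve-∀
      Δ[e₀]≡ : ∀ w → ∏Δ^ (suc k ∷ ks) w ≡ Δ[ 1 ∷ 0ᵛ ] (∏Δ^ (k ∷ ks)) w
      Δ[e₀]≡ (t ∷ v) =
        trans (distribʳ-- (Δ^ k f t) (Δ^ k f (suc t)) (∏Δ^ ks v))
              (cong₂ (λ s u → Δ^ k f t * ∏Δ^ ks v - Δ^ k f s * ∏Δ^ ks u)
                     (ℕ.+-comm 1 t) (sym (+ᵛ-identityʳ v)))

    Δ[t∷0]∏Δ^-spanned : ∀ {d} t k (ks : Vec ℕ d) →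
                        Spanned (suc (k ℕ.+ Vec.sum ks)) (Δ[ t ∷ 0ᵛ ] (∏Δ^ (k ∷ ks)))
    Δ[t∷0]∏Δ^-spanned zero    k ks = ext (λ v → sym (Δ[0ᵛ]≡0 (∏Δ^ (k ∷ ks)) v)) null
    Δ[t∷0]∏Δ^-spanned (suc t) k ks =
      Δ[+ᵛ]-spanned (1 ∷ 0ᵛ) (t ∷ 0ᵛ) (∏Δ^ (k ∷ ks)) (cong (suc t ∷_) (+ᵛ-identityˡ 0ᵛ))
                    (Δ[e₀]∏Δ^-spanned k ks) (Δ[t∷0]∏Δ^-spanned t k ks)

    Δ∏Δ^-spanned : ∀ {d} g (ks : Vec ℕ d) → Spanned (suc (Vec.sum ks)) (Δ[ g ] (∏Δ^ ks))
    Δ∏Δ^-spanned []      []       = null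
    Δ∏Δ^-spanned (t ∷ g) (k ∷ ks) =
      Δ[+ᵛ]-spanned (t ∷ 0ᵛ) (0 ∷ g) (∏Δ^ (k ∷ ks)) (cong₂ _∷_ (ℕ.+-identityʳ t) (+ᵛ-identityˡ g))
                    (Δ[t∷0]∏Δ^-spanned t k ks) Δ[0∷g]
      where
      distribˡ-- : ∀ a b c → a * (b - c) ≡ a * b - a * c
      distribˡ-- = solve-∀
      Δ[0∷g]≡ : ∀ w → (Δ^ k f ⊗ Δ[ g ] (∏Δ^ ks)) w ≡ Δ[ 0 ∷ g ] (∏Δ^ (k ∷ ks)) w
      Δ[0∷g]≡ (s ∷ v) =
        trans (distribˡ-- (Δ^ k f s) (∏Δ^ ks v) (∏Δ^ ks (v +ᵛ g)))
              (cong (λ s′ → Δ^ k f s * ∏Δ^ ks v - Δ^ k f s′ * ∏Δ^ ks (v +ᵛ g)) (sym (ℕ.+-identityʳ s)))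
      Δ[0∷g] : Spanned (suc (k ℕ.+ Vec.sum ks)) (Δ[ 0 ∷ g ] (∏Δ^ (k ∷ ks)))
      Δ[0∷g] = ext Δ[0∷g]≡ (weaken (ℕ.≤-reflexive (sym (ℕ.+-suc k (Vec.sum ks))))
                                   (Δ^⊗-spanned k (Δ∏Δ^-spanned g ks)))

    Δ-spanned : ∀ {d b} {φ : Fn d} g → Spanned b φ → Spanned (suc b) (Δ[ g ] φ)
    Δ-spanned g (product ks b≤) = weaken (s≤s b≤) (Δ∏Δ^-spanned g ks)
    Δ-spanned g null            = null
    Δ-spanned g (add {φ} {ψ} x y) =
      ext (λ v → interchange (φ v) (ψ v) (φ (v +ᵛ g)) (ψ (v +ᵛ g))) (add (Δ-spanned g x) (Δ-spanned g y))
      where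
      interchange : ∀ a b c e → a - c + (b - e) ≡ a + b - (c + e)
      interchange = solve-∀
    Δ-spanned g (shift h {φ} x) =
      ext (λ v → cong (λ u → φ (v +ᵛ h) - φ u) (+ᵛ-swapʳ v h g)) (shift h (Δ-spanned g x))
    Δ-spanned g (ext φ≗ψ x)     = ext (λ v → cong₂ _-_ (φ≗ψ v) (φ≗ψ (v +ᵛ g))) (Δ-spanned g x)

    ∏Δ^-vanishing : ∀ {q m} → (∀ {k} → m < k → ∀ x → q ∣ᶻ Δ^ k f x) →
                    ∀ {d} (ks : Vec ℕ d) v → d ℕ.* m < Vec.sum ks → q ∣ᶻ ∏Δ^ ks v
    ∏Δ^-vanishing         Δ^>m [] [] ()
    ∏Δ^-vanishing {m = m} Δ^>m (k ∷ ks) (t ∷ v) bound with m ℕ.<? k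
    ... | yes m<k = ∣m⇒∣m*n (∏Δ^ ks v) (Δ^>m m<k t)
    ... | no  m≮k = ∣n⇒∣m*n (Δ^ k f t) (∏Δ^-vanishing Δ^>m ks v (m+n<o+p∧o≤m⇒n<p bound (ℕ.≮⇒≥ m≮k)))

    spanned-vanishing : ∀ {q m} → (∀ {k} → m < k → ∀ x → q ∣ᶻ Δ^ k f x) →
                        ∀ {d b} {φ : Fn d} → Spanned b φ → d ℕ.* m < b → ∀ v → q ∣ᶻ φ v
    spanned-vanishing Δ^>m (product ks b≤) bound v = ∏Δ^-vanishing Δ^>m ks v (ℕ.<-≤-trans bound b≤)
    spanned-vanishing Δ^>m null            bound v = ∣ᶻ0
    spanned-vanishing Δ^>m (add x y)       bound v =
      ∣m∣n⇒∣m+n (spanned-vanishing Δ^>m x bound v) (spanned-vanishing Δ^>m y bound v)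
    spanned-vanishing Δ^>m (shift g x)     bound v = spanned-vanishing Δ^>m x bound (v +ᵛ g)
    spanned-vanishing {q} Δ^>m (ext φ≗ψ x) bound v =
      subst (q ∣ᶻ_) (φ≗ψ v) (spanned-vanishing Δ^>m x bound v)

    choice-spanned : ∀ {d b} (y : Vec ℕ d) r m {φ : Fn d} → Spanned b φ → Spanned (m ℕ.+ b) (choice y r m φ)
    choice-spanned y r       zero    x = x
    choice-spanned y zero    (suc m) x = Δ-spanned y (choice-spanned y zero m x)
    choice-spanned y (suc r) (suc m) x =
      add (shift y (choice-spanned y r (suc m) x)) (Δ-spanned y (choice-spanned y (suc r) m x))


open import Data.Nat using (_+_; _*_; _∸_; _≥_)
open import Data.Nat.Divisibility using (_∣_; _∣?_; ∣m+n∣m⇒∣n; ∣m∣n⇒∣m+n; ∣-refl; _∣0; ∣1⇒≡1)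

window-admissible : ∀ r w j → j < w ∸ 2 * r → r ≤ suc (ℕ.pred r + j) × suc (ℕ.pred r + j) + r ≤ w
window-admissible zero     w j j<w = z≤n , ℕ.≤-trans (ℕ.≤-reflexive (ℕ.+-identityʳ (suc j))) j<w
window-admissible (suc r₀) w j j<w∸2r =
  s≤s (ℕ.m≤m+n r₀ j) , ℕ.≤-trans (ℕ.≤-reflexive regroup) (ℕ.<⇒≤ j+2r<w)
  where
  2r : ℕ
  2r = 2 * suc r₀
  j+2r<w : j + 2r < w
  j+2r<w = ℕ.<-≤-trans (ℕ.+-monoˡ-< 2r j<w∸2r)
             (ℕ.≤-reflexive (ℕ.m∸n+n≡m {w} {2r} (ℕ.<⇒≤ (ℕ.m∸n≢0⇒n<m (ℕ.m<n⇒n≢0 j<w∸2r)))))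
  regroup : suc (r₀ + j) + suc r₀ ≡ j + 2r
  regroup = identity r₀ j
    where
    identity : ∀ r₀ j → suc (r₀ + j) + suc r₀ ≡ j + 2 * suc r₀
    identity = ℕ-Solver.solve-∀

sum-map≤sum-map-∸ : ∀ {A : Set} c (w : A → ℕ) (Y : List A) →
                    sum (map w Y) ≤ sum (map (λ y → w y ∸ c) Y) + c * length Y
sum-map≤sum-map-∸ c w []      = z≤n
sum-map≤sum-map-∸ c w (y ∷ Y) = begin
  w y + sum (map w Y)
    ≤⟨ ℕ.+-mono-≤ (ℕ.m≤n+m∸n (w y) c) (sum-map≤sum-map-∸ c w Y) ⟩
  (c + (w y ∸ c)) + (sum (map (λ y → w y ∸ c) Y) + c * length Y)
    ≡⟨ regroup (w y ∸ c) c (sum (map (λ y → w y ∸ c) Y)) (length Y) ⟩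
  (w y ∸ c + sum (map (λ y → w y ∸ c) Y)) + c * suc (length Y) ∎
  where
  open ℕ.≤-Reasoning
  regroup : ∀ a c s n → (c + a) + (s + c * n) ≡ (a + s) + c * suc n
  regroup = ℕ-Solver.solve-∀

⊎-∀< : ∀ {A : Set} {P : ℕ → Set} n → (∀ j → j < n → A ⊎ P j) → A ⊎ (∀ j → j < n → P j)
⊎-∀< zero    _      = inj₂ λ _ ()
⊎-∀< (suc n) A⊎P with A⊎P 0 (s≤s z≤n) | ⊎-∀< n (λ j j<n → A⊎P (suc j) (s≤s j<n))
... | inj₁ a  | _       = inj₁ a
... | inj₂ _  | inj₁ a  = inj₁ a
... | inj₂ P₀ | inj₂ Pₛ = inj₂ λ { zero _ → P₀ ; (suc j) (s≤s j<n) → Pₛ j j<n }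

indicator : ℕ → ℕ → ℤ
indicator p t with p ∣? t
... | yes _ = 1ℤ
... | no  _ = 0ℤ

indicator-periodic : ∀ p t → indicator p (t + p) ≡ indicator p t
indicator-periodic p t with p ∣? (t + p) | p ∣? t
... | yes _      | yes _   = refl
... | no  _      | no  _   = refl
... | yes p∣t+p  | no  p∤t = contradiction (∣m+n∣m⇒∣n (subst (p ∣_) (ℕ.+-comm t p) p∣t+p) ∣-refl) p∤t
... | no  p∤t+p  | yes p∣t = contradiction (∣m∣n⇒∣m+n p∣t ∣-refl) p∤t+p

indicator≡0⊎∣ : ∀ p t → indicator p t ≡ 0ℤ ⊎ p ∣ t
indicator≡0⊎∣ p t with p ∣? t
... | yes p∣t = inj₂ p∣t
... | no  _   = inj₁ refl

indicator[0]≡1 : ∀ p → indicator p 0 ≡ 1ℤ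
indicator[0]≡1 p with p ∣? 0
... | yes _   = refl
... | no  p∤0 = contradiction (p ∣0) p∤0

lookup-iterate-+ᵛ : ∀ {d} (y s : Vec ℕ d) k i → lookup (iterate (_+ᵛ y) s k) i ≡ lookup s i + k * lookup y i
lookup-iterate-+ᵛ y s zero    i = sym (ℕ.+-identityʳ (lookup s i))
lookup-iterate-+ᵛ y s (suc k) i = begin
  lookup (iterate (_+ᵛ y) (s +ᵛ y) k) i  ≡⟨ lookup-iterate-+ᵛ y (s +ᵛ y) k i ⟩
  lookup (s +ᵛ y) i + k * lookup y i      ≡⟨ cong (_+ k * lookup y i) (Vec.lookup-zipWith _+_ i s y) ⟩
  lookup s i + lookup y i + k * lookup y i ≡⟨ ℕ.+-assoc (lookup s i) (lookup y i) (k * lookup y i) ⟩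
  lookup s i + suc k * lookup y i         ∎
  where open ≡-Reasoning

latticeIndicator : ∀ p {d} → Fn d
latticeIndicator p = DifferenceProducts.∏Δ^ (indicator p) (replicate _ 0)

latticeIndicator≡0⊎∣ : ∀ p {d} (v : Vec ℕ d) → latticeIndicator p v ≡ 0ℤ ⊎ (∀ i → p ∣ lookup v i)
latticeIndicator≡0⊎∣ p []      = inj₂ λ ()
latticeIndicator≡0⊎∣ p (t ∷ v) with indicator≡0⊎∣ p t | latticeIndicator≡0⊎∣ p v
... | inj₁ e   | _        =
  inj₁ (trans (cong (ℤ._* latticeIndicator p v) e) (ℤ.*-zeroˡ (latticeIndicator p v)))
... | inj₂ _   | inj₁ e   = inj₁ (trans (cong (indicator p t ℤ.*_) e) (ℤ.*-zeroʳ (indicator p t)))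
... | inj₂ p∣t | inj₂ p∣v = inj₂ λ { Fin.zero → p∣t ; (Fin.suc i) → p∣v i }

latticeIndicator[0]≡1 : ∀ p {d} → latticeIndicator p {d} 0ᵛ ≡ 1ℤ
latticeIndicator[0]≡1 p {zero}  = refl
latticeIndicator[0]≡1 p {suc d} = cong₂ ℤ._*_ (indicator[0]≡1 p) (latticeIndicator[0]≡1 p {d})

p∣Δ^k-indicator : ∀ {p} → Prime p → ∀ {k} → p ∸ 1 < k → ∀ x → + p ∣ᶻ Δ^ k (indicator p) x
p∣Δ^k-indicator {zero}  p-prime _ = contradiction p-prime ¬prime[0]
p∣Δ^k-indicator {suc n} p-prime n<k = periodic⇒p∣Δ^k p-prime (indicator-periodic (suc n)) n<k

module Solutions (p d r : ℕ) (w : Point p d → ℕ) where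

  open DifferenceProducts (indicator p)

  coords : Point p d → Vec ℕ d
  coords = Vec.map toℕ

  margin : Point p d → ℕ
  margin y = w y ∸ 2 * r

  Admissible : Point p d → ℕ → Set
  Admissible y k = k ≡ 0 ⊎ (r ≤ k × k + r ≤ w y)

  combination : List (Point p d) → (Point p d → ℕ) → Vec ℕ d → Vec ℕ d
  combination []      a s = s
  combination (y ∷ Y) a s = combination Y a (iterate (_+ᵛ coords y) s (a y))

  Solves : List (Point p d) → Vec ℕ d → (Point p d → ℕ) → Set
  Solves Y s a = (∀ y → y ∈ Y → Admissible y (a y)) × (∀ i → p ∣ lookup (combination Y a s) i)

  Found : List (Point p d) → Vec ℕ d → Set
  Found Y s = ∃[ a ] ((∃[ y ] (y ∈ Y × a y ≢ 0)) × Solves Y s a)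

  lookup-combination : ∀ Y a s i → lookup (combination Y a s) i ≡ lookup s i + coordSum Y a i
  lookup-combination []      a s i = sym (ℕ.+-identityʳ (lookup s i))
  lookup-combination (y ∷ Y) a s i = begin
    lookup (combination Y a s′) i
      ≡⟨ lookup-combination Y a s′ i ⟩
    lookup s′ i + coordSum Y a i
      ≡⟨ cong (_+ coordSum Y a i) (lookup-iterate-+ᵛ (coords y) s (a y) i) ⟩
    lookup s i + a y * lookup (coords y) i + coordSum Y a i
      ≡⟨ cong (λ c → lookup s i + a y * c + coordSum Y a i) (Vec.lookup-map i toℕ y) ⟩
    lookup s i + a y * toℕ (lookup y i) + coordSum Y a i
      ≡⟨ ℕ.+-assoc (lookup s i) (a y * toℕ (lookup y i)) (coordSum Y a i) ⟩
    lookup s i + coordSum (y ∷ Y) a i ∎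
    where
    open ≡-Reasoning
    s′ : Vec ℕ d
    s′ = iterate (_+ᵛ coords y) s (a y)

  combination-cong : ∀ Y {a b} → (∀ z → z ∈ Y → a z ≡ b z) → ∀ s → combination Y a s ≡ combination Y b s
  combination-cong []      a≗b s = refl
  combination-cong (y ∷ Y) a≗b s =
    trans (cong (λ k → combination Y _ (iterate (_+ᵛ coords y) s k)) (a≗b y (here refl)))
          (combination-cong Y (λ z z∈Y → a≗b z (there z∈Y)) _)

  combination-zero : ∀ Y s → combination Y (λ _ → 0) s ≡ s
  combination-zero []      s = refl
  combination-zero (y ∷ Y) s = combination-zero Y s

  _[_≔_] : (Point p d → ℕ) → Point p d → ℕ → Point p d → ℕ
  (a [ y ≔ k ]) z with Vec.≡-dec Fin._≟_ z y
  ... | yes _ = k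
  ... | no  _ = a z

  update-≡ : ∀ a y k → (a [ y ≔ k ]) y ≡ k
  update-≡ a y k with Vec.≡-dec Fin._≟_ y y
  ... | yes _   = refl
  ... | no  y≢y = contradiction refl y≢y

  update-≢ : ∀ a {y z} k → y ≢ z → (a [ y ≔ k ]) z ≡ a z
  update-≢ a {y} {z} k y≢z with Vec.≡-dec Fin._≟_ z y
  ... | yes z≡y = contradiction (sym z≡y) y≢z
  ... | no  _   = refl

  solves-∷ : ∀ {y Y s k a} → All (y ≢_) Y → Admissible y k →
             Solves Y (iterate (_+ᵛ coords y) s k) a → Solves (y ∷ Y) s (a [ y ≔ k ])
  solves-∷ {y} {Y} {s} {k} {a} y∉Y adm (admY , divisible) = admissible , divisible′
    where
    agree : ∀ z → z ∈ Y → (a [ y ≔ k ]) z ≡ a z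
    agree z z∈Y = update-≢ a k (All.lookup y∉Y z∈Y)
    admissible : ∀ z → z ∈ y ∷ Y → Admissible z ((a [ y ≔ k ]) z)
    admissible z (here refl)  = subst (Admissible y) (sym (update-≡ a y k)) adm
    admissible z (there z∈Y) = subst (Admissible z) (sym (agree z z∈Y)) (admY z z∈Y)
    same-point : combination (y ∷ Y) (a [ y ≔ k ]) s ≡ combination Y a (iterate (_+ᵛ coords y) s k)
    same-point =
      trans (cong (λ k′ → combination Y (a [ y ≔ k ]) (iterate (_+ᵛ coords y) s k′)) (update-≡ a y k))
            (combination-cong Y agree _)
    divisible′ : ∀ i → p ∣ lookup (combination (y ∷ Y) (a [ y ≔ k ]) s) i
    divisible′ i = subst (λ v → p ∣ lookup v i) (sym same-point) (divisible i)

  solves-zero : ∀ Y {s} → (∀ i → p ∣ lookup s i) → Solves Y s (λ _ → 0)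
  solves-zero Y {s} p∣s =
    (λ _ _ → inj₁ refl) , λ i → subst (λ v → p ∣ lookup v i) (sym (combination-zero Y s)) (p∣s i)

  found-∷-skip : ∀ {y Y s} → All (y ≢_) Y → Found Y s → Found (y ∷ Y) s
  found-∷-skip {y} y∉Y (a , (z , z∈Y , az≢0) , solves) =
    a [ y ≔ 0 ] , (z , there z∈Y , az≢0 ∘′ trans (sym (update-≢ a 0 (All.lookup y∉Y z∈Y)))) ,
    solves-∷ y∉Y (inj₁ refl) solves

  found-∷-here : ∀ {y Y s k a} → All (y ≢_) Y → k ≢ 0 → Admissible y k →
                 Solves Y (iterate (_+ᵛ coords y) s k) a → Found (y ∷ Y) s
  found-∷-here {y} {k = k} {a} y∉Y k≢0 adm solves =
    a [ y ≔ k ] , (y , here refl , k≢0 ∘′ trans (sym (update-≡ a y k))) , solves-∷ y∉Y adm solves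

  -- choice y (pred r) (margin y) uses the translates by k·y for k in [pred r + 1, pred r + margin y];
  -- starting at pred r + 1 rather than r keeps k = 0 out of the window when r = 0.
  choices : List (Point p d) → Fn d → Fn d
  choices []      φ = φ
  choices (y ∷ Y) φ = choice (coords y) (ℕ.pred r) (margin y) (choices Y φ)

  choices-spanned : ∀ Y {φ} → Spanned 0 φ → Spanned (sum (map margin Y)) (choices Y φ)
  choices-spanned []      φ-spanned = φ-spanned
  choices-spanned (y ∷ Y) φ-spanned =
    choice-spanned (coords y) (ℕ.pred r) (margin y) (choices-spanned Y φ-spanned)

  δ : Fn d
  δ = latticeIndicator p

  found-∷⊎vanishes : ∀ {y Y} → All (y ≢_) Y → (∀ s → Found Y s ⊎ choices Y δ s ≡ δ s) →
                     ∀ s j → j < margin y →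
                     Found (y ∷ Y) s ⊎ choices Y δ (iterate (_+ᵛ coords y) s (suc (ℕ.pred r + j))) ≡ 0ℤ
  found-∷⊎vanishes {y} {Y} y∉Y search-Y s j j<margin = reached (search-Y s′) (latticeIndicator≡0⊎∣ p s′)
    where
    s′ : Vec ℕ d
    s′ = iterate (_+ᵛ coords y) s (suc (ℕ.pred r + j))
    admissible : Admissible y (suc (ℕ.pred r + j))
    admissible = inj₂ (window-admissible r (w y) j j<margin)
    reached : Found Y s′ ⊎ choices Y δ s′ ≡ δ s′ → δ s′ ≡ 0ℤ ⊎ (∀ i → p ∣ lookup s′ i) →
              Found (y ∷ Y) s ⊎ choices Y δ s′ ≡ 0ℤ
    reached (inj₁ (_ , _ , solves)) _           = inj₁ (found-∷-here y∉Y (λ ()) admissible solves)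
    reached (inj₂ fixed)            (inj₁ δ≡0) = inj₂ (trans fixed δ≡0)
    reached (inj₂ _)                (inj₂ p∣s′) =
      inj₁ (found-∷-here y∉Y (λ ()) admissible (solves-zero Y p∣s′))

  search : ∀ Y → Unique Y → ∀ s → Found Y s ⊎ choices Y δ s ≡ δ s
  search []      []              s = inj₂ refl
  search (y ∷ Y) (y∉Y ∷ unique) s with search Y unique s
  ... | inj₁ found = inj₁ (found-∷-skip y∉Y found)
  ... | inj₂ fixed with ⊎-∀< (margin y) (found-∷⊎vanishes y∉Y (search Y unique) s)
  ...   | inj₁ found = inj₁ found
  ...   | inj₂ zeros =
    inj₂ (trans (choice-fixes (coords y) (ℕ.pred r) (margin y) (choices Y δ) s zeros) fixed)

  choices-δ-vanishing : Prime p → ∀ Y → d * (p ∸ 1) < sum (map margin Y) → ∀ v → + p ∣ᶻ choices Y δ v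
  choices-δ-vanishing p-prime Y bound =
    spanned-vanishing (p∣Δ^k-indicator p-prime) (choices-spanned Y (product (replicate d 0) z≤n)) bound

lemma6 : (p d r : ℕ) → Prime p → d ≥ 1 →
         (Y : List (Point p d)) → Unique Y →
         (w : Point p d → ℕ) →
         sum (map w Y) ≥ d * (p ∸ 1) + 2 * r * length Y + 1 →
         ∃[ a ] ((∃[ y ] (y ∈ Y × a y ≢ 0))
                × (∀ y → y ∈ Y → (a y ≡ 0 ⊎ (r ≤ a y × a y + r ≤ w y)))
                × (∀ (i : Fin d) → p ∣ coordSum Y a i))
-- The argument does not need d ≥ 1.
lemma6 p d r p-prime _ Y unique w total = [ solution , ⊥-elim ∘′ nothing-found ] (search Y unique 0ᵛ)
  where
  open Solutions p d r w
  solution : Found Y 0ᵛ → ∃[ a ] ((∃[ y ] (y ∈ Y × a y ≢ 0)) × (∀ y → y ∈ Y → Admissible y (a y))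
                                 × (∀ i → p ∣ coordSum Y a i))
  solution (a , nonzero , admissible , p∣combination) =
    a , nonzero , admissible , λ i →
      subst (p ∣_) (trans (lookup-combination Y a 0ᵛ i) (cong (_+ coordSum Y a i) (Vec.lookup-replicate i 0)))
            (p∣combination i)
  margin-bound : d * (p ∸ 1) < sum (map margin Y)
  margin-bound = ℕ.+-cancelʳ-≤ (2 * r * length Y) (suc (d * (p ∸ 1))) (sum (map margin Y))
    (ℕ.≤-trans (ℕ.≤-reflexive (ℕ.+-comm 1 _)) (ℕ.≤-trans total (sum-map≤sum-map-∸ (2 * r) w Y)))
  nothing-found : choices Y δ 0ᵛ ≡ δ 0ᵛ → ⊥
  nothing-found fixed = ¬prime[1] (subst Prime (∣1⇒≡1 (∣⇒∣ᵤ p∣1)) p-prime)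
    where
    p∣1 : + p ∣ᶻ 1ℤ
    p∣1 = subst (+ p ∣ᶻ_) (trans fixed (latticeIndicator[0]≡1 p {d}))
                (choices-δ-vanishing p-prime Y margin-bound 0ᵛ)
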